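{- For any non-trivial non-empty graphs $G$ and $H$, $$\alpha(G\times H)\ \ge\ \mu(H)\,\alpha(G\times K_2)\ =\ \mu(H)\,\mu(G\times K_2)\ \ge\ 2\,\mu(G)\,\mu(H).$$
   Context: All graphs are finite and simple; a graph is non-trivial if it has at least two vertices and non-empty if it has at least one edge. $\alpha(\cdot)$ is the vertex cover number and $\mu(\cdot)$ the matching number (size of a largest matching). $K_2$ is the complete graph on two vertices. The direct product $G\times H$ has vertex set $V(G)\times V(H)$, with $(a,b)\sim(c,d)$ iff $ac\in E(G)$ and $bd\in E(H)$. -}

module Defs where

open import Data.Nat using (ℕ; suc; _*_; _≤_; _≥_)
open import Data.Fin using (Fin; zero; suc; quotient; remainder)
open import Data.Fin.Subset using (Subset; _∈_; ∣_∣)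
open import Data.Product using (Σ; ∃; _×_; _,_; proj₁; proj₂)
open import Data.Sum using (_⊎_)
open import Data.Empty using (⊥)
open import Relation.Nullary using (¬_)
open import Relation.Binary.PropositionalEquality using (_≡_; _≢_)

record Graph : Set₁ where
  field
    n     : ℕ
    Adj   : Fin n → Fin n → Set
    sym   : ∀ {x y} → Adj x y → Adj y x
    irrefl : ∀ {x} → ¬ Adj x x
open Graph public

NonTrivial : Graph → Set
NonTrivial G = 2 ≤ n G

NonEmpty : Graph → Set
NonEmpty G = Σ (Fin (n G)) λ x → Σ (Fin (n G)) λ y → Adj G x y

-- Direct (tensor / categorical) product; vertex (a , b) is encoded as
-- combine a b : Fin (n G * n H), decoded by quotient / remainder.
_×ᵍ_ : Graph → Graph → Graph
G ×ᵍ H = record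
  { n = n G * n H
  ; Adj = λ x y → Adj G (quotient (n H) x) (quotient (n H) y)
                × Adj H (remainder {n G} (n H) x) (remainder {n G} (n H) y)
  ; sym = λ { (p , q) → sym G p , sym H q }
  ; irrefl = λ { (p , q) → irrefl G p }
  }

K2Adj : Fin 2 → Fin 2 → Set
K2Adj x y = x ≢ y

K₂ : Graph
K₂ = record
  { n = 2
  ; Adj = K2Adj
  ; sym = λ p q → p (Relation.Binary.PropositionalEquality.sym q)
  ; irrefl = λ p → p Relation.Binary.PropositionalEquality.refl
  }

IsVertexCover : (G : Graph) → Subset (n G) → Set
IsVertexCover G S = ∀ x y → Adj G x y → (x ∈ S) ⊎ (y ∈ S)

-- k is the vertex cover number α(G): minimum size of a vertex cover
IsVertexCoverNumber : Graph → ℕ → Set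
IsVertexCoverNumber G k =
  (Σ (Subset (n G)) λ S → IsVertexCover G S × ∣ S ∣ ≡ k)
  × (∀ S → IsVertexCover G S → k ≤ ∣ S ∣)

record Matching (G : Graph) (k : ℕ) : Set where
  field
    fst  : Fin k → Fin (n G)
    snd  : Fin k → Fin (n G)
    edge : ∀ i → Adj G (fst i) (snd i)
    disj : ∀ i j → i ≢ j →
             (fst i ≢ fst j) × (fst i ≢ snd j) × (snd i ≢ fst j) × (snd i ≢ snd j)

IsMatchingNumber : Graph → ℕ → Set
IsMatchingNumber G k = Matching G k × (∀ j → Matching G j → j ≤ k)

-- Over each edge uv of a matching of H, the map (g , c) ↦ (g , u or v) embeds G × K₂
-- into G × H, and over disjoint edges the images are disjoint. So a maximum matching of
-- G × K₂ yields a matching of size μ(H) μ(G × K₂) in G × H, and every vertex cover meets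
-- its edges in distinct vertices. An edge uv of G gives the two disjoint edges
-- (u , r)(v , 1 - r) of G × K₂, whence μ(G × K₂) ≥ 2 μ(G). Finally G × K₂ is bipartite,
-- coloured by its K₂ coordinate, so α(G × K₂) = μ(G × K₂) by Kőnig's theorem, proved by
-- augmenting along shortest alternating paths.
module Submission where

open import Defs hiding (sym)
open import Data.Nat using (ℕ; zero; suc; _*_; _≤_; _<_; _≥_; z≤n; s≤s; _≤?_)
open import Data.Nat.Properties
  using (≤-refl; ≤-trans; ≤-antisym; m≤n⇒m≤1+n; 1+n≰n; ≮⇒≥; *-comm; *-monoʳ-≤; module ≤-Reasoning)
open import Data.Nat.Induction using (<-wellFounded)
open import Data.Fin using (Fin; zero; suc; _≟_; combine; quotient; remainder; remQuot)
open import Data.Fin.Properties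
  using ( 0≢1+n; suc-injective; any?; injective⇒≤
        ; remQuot-combine; combine-remQuot; combine-injective)
open import Data.Fin.Subset using (Subset; _∈_; ∣_∣; _-_; ⊤; inside; outside)
open import Data.Fin.Subset.Properties using (∈⊤; ∣⊤∣≡n; x∈p∧x≢y⇒x∈p-y; x∈p⇒∣p-x∣<∣p∣)
open import Data.Vec using ([]; _∷_; here; there; tabulate)
open import Data.Vec.Properties using (lookup∘tabulate; lookup⇒[]=; []=⇒lookup)
open import Data.Vec.Functional using (updateAt) renaming (_∷_ to _∷ᶠ_)
open import Data.Vec.Functional.Properties using (updateAt-updates; updateAt-minimal)
open import Data.Product using (∃; _×_; _,_; proj₁; proj₂)
open import Data.Sum using (_⊎_; inj₁; inj₂)
open import Function using (_∘_; const)
open import Function.Definitions using (Injective)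
open import Induction.WellFounded using (Acc; acc)
open import Relation.Nullary using (¬_; Dec; yes; no; does; contradiction)
open import Relation.Nullary.Decidable using (decidable-stable; ¬¬-excluded-middle)
open import Relation.Nullary.Negation using (¬¬-Monad; ¬¬-map)
open import Relation.Binary.PropositionalEquality
  using (_≡_; _≢_; refl; sym; trans; cong; cong₂; subst; subst₂; module ≡-Reasoning)
open import Effect.Monad using (RawMonad)
open import Level using (0ℓ)

open RawMonad (¬¬-Monad {0ℓ}) using (pure; _>>=_)

¬¬-∀ : ∀ {n} {P : Fin n → Set} → (∀ i → ¬ ¬ P i) → ¬ ¬ (∀ i → P i)
¬¬-∀ {zero} _ = pure λ ()
¬¬-∀ {suc n} ¬¬P = do
  P₀ ← ¬¬P zero
  Pₛ ← ¬¬-∀ (¬¬P ∘ suc)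
  pure λ { zero → P₀ ; (suc i) → Pₛ i }

¬¬-least : ∀ {P : ℕ → Set} {d} → P d →
  ¬ ¬ (∃ λ d′ → d′ ≤ d × P d′ × ∀ e → e < d′ → ¬ P e)
¬¬-least {d = zero} p = pure (zero , z≤n , p , λ _ ())
¬¬-least {P} {suc d} p = ¬¬-excluded-middle {A = P zero} >>= λ
  { (yes p₀) → pure (zero , z≤n , p₀ , λ _ ())
  ; (no ¬p₀) → do
      (d′ , d′≤d , p′ , least) ← ¬¬-least {P ∘ suc} p
      pure (suc d′ , s≤s d′≤d , p′ , λ { zero _ → ¬p₀ ; (suc e) (s≤s e<d′) → least e e<d′ }) }

¬¬-maximum : ∀ {Q : ℕ → Set} {k₀} B → (∀ k → Q k → k ≤ B) → Q k₀ →
  ¬ ¬ (∃ λ k → Q k × ∀ j → Q j → j ≤ k)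
¬¬-maximum zero bounded q = pure (_ , q , λ j qj → ≤-trans (bounded j qj) z≤n)
¬¬-maximum {Q} (suc B) bounded q = ¬¬-excluded-middle {A = ∃ λ k → Q k × B < k} >>= λ
  { (yes (k , qk , B<k)) → pure (k , qk , λ j qj → ≤-trans (bounded j qj) B<k)
  ; (no ¬above) → ¬¬-maximum B (λ k qk → ≮⇒≥ (λ B<k → ¬above (k , qk , B<k))) q }

injectiveOn⇒∣p∣≤∣q∣ : ∀ {m n} {p : Subset m} {q : Subset n} (f : ∀ {x} → x ∈ p → Fin n) →
  (∀ {x} (x∈p : x ∈ p) → f x∈p ∈ q) →
  (∀ {x y} (x∈p : x ∈ p) (y∈p : y ∈ p) → f x∈p ≡ f y∈p → x ≡ y) →
  ∣ p ∣ ≤ ∣ q ∣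
injectiveOn⇒∣p∣≤∣q∣ {p = []} f f∈q f-inj = z≤n
injectiveOn⇒∣p∣≤∣q∣ {p = outside ∷ p} f f∈q f-inj =
  injectiveOn⇒∣p∣≤∣q∣ (f ∘ there) (f∈q ∘ there)
    (λ x∈p y∈p eq → suc-injective (f-inj (there x∈p) (there y∈p) eq))
injectiveOn⇒∣p∣≤∣q∣ {p = inside ∷ p} {q} f f∈q f-inj = begin
  suc ∣ p ∣           ≤⟨ s≤s (injectiveOn⇒∣p∣≤∣q∣ (f ∘ there) f∈q-f₀ (λ x∈p y∈p eq →
                           suc-injective (f-inj (there x∈p) (there y∈p) eq))) ⟩
  suc ∣ q - f here ∣  ≤⟨ x∈p⇒∣p-x∣<∣p∣ (f∈q here) ⟩
  ∣ q ∣               ∎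
  where
  open ≤-Reasoning
  f∈q-f₀ : ∀ {x} (x∈p : x ∈ p) → f (there x∈p) ∈ q - f here
  f∈q-f₀ x∈p = x∈p∧x≢y⇒x∈p-y (f∈q (there x∈p)) (λ eq → 0≢1+n (f-inj here (there x∈p) (sym eq)))

module _ {n} {P : Fin n → Set} (P? : ∀ x → Dec (P x)) where

  ∈-tabulate⁺ : ∀ {x} → P x → x ∈ tabulate (does ∘ P?)
  ∈-tabulate⁺ {x} Px with P? x in eq
  ... | yes _ = lookup⇒[]= x _ (trans (lookup∘tabulate (does ∘ P?) x) (cong does eq))
  ... | no ¬Px = contradiction Px ¬Px

  ∈-tabulate⁻ : ∀ {x} → x ∈ tabulate (does ∘ P?) → P x
  ∈-tabulate⁻ {x} x∈ with P? x | trans (sym (lookup∘tabulate (does ∘ P?) x)) ([]=⇒lookup x∈)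
  ... | yes Px | _ = Px
  ... | no _ | ()

preimage : ∀ {k n} (f : Fin k → Fin n) {v} → ¬ (∀ i → f i ≢ v) → ∃ λ i → f i ≡ v
preimage f {v} ¬missed with any? (λ i → f i ≟ v)
... | yes hit = hit
... | no ¬hit = contradiction (λ i fi≡v → ¬hit (i , fi≡v)) ¬missed

∷ᶠ-injective : ∀ {k n} {f : Fin k → Fin n} {a} → (∀ i → f i ≢ a) →
  Injective _≡_ _≡_ f → Injective _≡_ _≡_ (a ∷ᶠ f)
∷ᶠ-injective fresh f-inj {zero} {zero} _ = refl
∷ᶠ-injective fresh f-inj {zero} {suc j} eq = contradiction (sym eq) (fresh j)
∷ᶠ-injective fresh f-inj {suc i} {zero} eq = contradiction eq (fresh i)
∷ᶠ-injective fresh f-inj {suc i} {suc j} eq = cong suc (f-inj eq)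

module UpdateAt {k} {A : Set} (f : Fin k → A) (i : Fin k) (a : A) where

  updated : updateAt f i (const a) i ≡ a
  updated = updateAt-updates i f

  kept : ∀ {j} → j ≢ i → updateAt f i (const a) j ≡ f j
  kept j≢i = updateAt-minimal _ i f j≢i

  updateAt-injective : (∀ j → f j ≢ a) → Injective _≡_ _≡_ f →
    Injective _≡_ _≡_ (updateAt f i (const a))
  updateAt-injective fresh f-inj {j} {j′} eq with j ≟ i | j′ ≟ i
  ... | yes refl | yes refl = refl
  ... | yes refl | no j′≢i =
    contradiction (trans (sym (kept j′≢i)) (trans (sym eq) updated)) (fresh j′)
  ... | no j≢i | yes refl =
    contradiction (trans (sym (kept j≢i)) (trans eq updated)) (fresh j)
  ... | no j≢i | no j′≢i = f-inj (trans (sym (kept j≢i)) (trans eq (kept j′≢i)))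

module _ {G : Graph} {k : ℕ} (M : Matching G k) where
  open Matching M

  ends : Fin k → Fin 2 → Fin (n G)
  ends i zero = fst i
  ends i (suc zero) = snd i

  ends-adjacent : ∀ i {s t} → s ≢ t → Adj G (ends i s) (ends i t)
  ends-adjacent i {zero} {zero} s≢t = contradiction refl s≢t
  ends-adjacent i {zero} {suc zero} _ = edge i
  ends-adjacent i {suc zero} {zero} _ = Graph.sym G (edge i)
  ends-adjacent i {suc zero} {suc zero} s≢t = contradiction refl s≢t

  ends-disjoint : ∀ {i j} → i ≢ j → ∀ s t → ends i s ≢ ends j t
  ends-disjoint i≢j zero zero = proj₁ (disj _ _ i≢j)
  ends-disjoint i≢j zero (suc zero) = proj₁ (proj₂ (disj _ _ i≢j))
  ends-disjoint i≢j (suc zero) zero = proj₁ (proj₂ (proj₂ (disj _ _ i≢j)))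
  ends-disjoint i≢j (suc zero) (suc zero) = proj₂ (proj₂ (proj₂ (disj _ _ i≢j)))

  ends-injective : ∀ {i j} s t → ends i s ≡ ends j t → i ≡ j × s ≡ t
  ends-injective {i} {j} s t eq with i ≟ j | s ≟ t
  ... | no i≢j | _ = contradiction eq (ends-disjoint i≢j s t)
  ... | yes refl | yes s≡t = refl , s≡t
  ... | yes refl | no s≢t =
    contradiction (subst (Adj G (ends i s)) (sym eq) (ends-adjacent i s≢t)) (irrefl G)

fromEnds : ∀ {G : Graph} {k} (e : Fin k → Fin 2 → Fin (n G)) →
  (∀ i → Adj G (e i zero) (e i (suc zero))) → (∀ {i j s t} → e i s ≡ e j t → i ≡ j) →
  Matching G k
fromEnds e edge e-inj = record
  { fst = λ i → e i zero
  ; snd = λ i → e i (suc zero)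
  ; edge = edge
  ; disj = λ i j i≢j → apart i≢j , apart i≢j , apart i≢j , apart i≢j
  }
  where
  apart : ∀ {i j s t} → i ≢ j → e i s ≢ e j t
  apart i≢j = i≢j ∘ e-inj

remQuot-injective : ∀ {m} k {x y : Fin (m * k)} →
  quotient {m} k x ≡ quotient {m} k y → remainder {m} k x ≡ remainder {m} k y → x ≡ y
remQuot-injective {m} k {x} {y} q≡ r≡ = begin
  x                                                  ≡⟨ sym (combine-remQuot {m} k x) ⟩
  combine (quotient {m} k x) (remainder {m} k x)     ≡⟨ cong₂ combine q≡ r≡ ⟩
  combine (quotient {m} k y) (remainder {m} k y)     ≡⟨ combine-remQuot {m} k y ⟩
  y                                                  ∎
  where open ≡-Reasoning

fromEnds² : ∀ {G : Graph} {a b} (e : Fin a → Fin b → Fin 2 → Fin (n G)) →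
  (∀ i p → Adj G (e i p zero) (e i p (suc zero))) →
  (∀ {i j p q s t} → e i p s ≡ e j q t → i ≡ j × p ≡ q) →
  Matching G (a * b)
fromEnds² {a = a} {b} e edge e-inj =
  fromEnds (λ x → e (quotient {a} b x) (remainder {a} b x)) (λ x → edge _ _)
    (λ eq → let i≡j , p≡q = e-inj eq in remQuot-injective b i≡j p≡q)

matching≤cover : ∀ {G : Graph} {k S} → Matching G k → IsVertexCover G S → k ≤ ∣ S ∣
matching≤cover {G} {k} {S} M S-covers =
  subst (_≤ ∣ S ∣) (∣⊤∣≡n k)
    (injectiveOn⇒∣p∣≤∣q∣ {p = ⊤} (λ {i} _ → ends M i (coveredEnd i)) (λ {i} _ → proj₂ (covered i))
      (λ {i} {j} _ _ eq → proj₁ (ends-injective M (coveredEnd i) (coveredEnd j) eq)))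
  where
  covered : ∀ i → ∃ λ s → ends M i s ∈ S
  covered i with S-covers _ _ (Matching.edge M i)
  ... | inj₁ fst∈S = zero , fst∈S
  ... | inj₂ snd∈S = suc zero , snd∈S
  coveredEnd : Fin k → Fin 2
  coveredEnd = proj₁ ∘ covered

matching≤coverNumber : ∀ {G : Graph} {k a} → Matching G k → IsVertexCoverNumber G a → k ≤ a
matching≤coverNumber M ((S , S-covers , ∣S∣≡a) , _) = subst (_ ≤_) ∣S∣≡a (matching≤cover M S-covers)

×-adjacent : ∀ (G H : Graph) {a b s t} → Adj G a b → Adj H s t →
  Adj (G ×ᵍ H) (combine a s) (combine b t)
×-adjacent G H {a} {b} {s} {t} a~b s~t =
  subst₂ (Adj G) (cong proj₁ a,s) (cong proj₁ b,t) a~b ,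
  subst₂ (Adj H) (cong proj₂ a,s) (cong proj₂ b,t) s~t
  where
  a,s : (a , s) ≡ remQuot (n H) (combine a s)
  a,s = sym (remQuot-combine a s)
  b,t : (b , t) ≡ remQuot (n H) (combine b t)
  b,t = sym (remQuot-combine b t)

_⊕_ : Fin 2 → Fin 2 → Fin 2
zero ⊕ t = t
suc zero ⊕ zero = suc zero
suc zero ⊕ suc zero = zero

⊕-cancelʳ : ∀ r r′ s → r ⊕ s ≡ r′ ⊕ s → r ≡ r′
⊕-cancelʳ zero zero s _ = refl
⊕-cancelʳ (suc zero) (suc zero) s _ = refl
⊕-cancelʳ zero (suc zero) zero ()
⊕-cancelʳ zero (suc zero) (suc zero) ()
⊕-cancelʳ (suc zero) zero zero ()
⊕-cancelʳ (suc zero) zero (suc zero) ()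

⊕-separates : ∀ r → r ⊕ zero ≢ r ⊕ suc zero
⊕-separates zero ()
⊕-separates (suc zero) ()

matching-×K₂ : ∀ {G : Graph} {k} → Matching G k → Matching (G ×ᵍ K₂) (k * 2)
matching-×K₂ {G} M =
  fromEnds² (λ i r s → combine (ends M i s) (r ⊕ s))
    (λ i r → ×-adjacent G K₂ (Matching.edge M i) (⊕-separates r)) injective
  where
  injective : ∀ {i j r r′ s t} → combine (ends M i s) (r ⊕ s) ≡ combine (ends M j t) (r′ ⊕ t) →
    i ≡ j × r ≡ r′
  injective {i} {j} {r} {r′} {s} {t} eq with combine-injective _ _ _ _ eq
  ... | ends≡ , ⊕≡ with ends-injective M s t ends≡
  ... | refl , refl = refl , ⊕-cancelʳ r r′ s ⊕≡

module _ {G H : Graph} {a} (MH : Matching H a) where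

  embedAlong : Fin a → Fin (n G * 2) → Fin (n G * n H)
  embedAlong i w = combine (quotient {n G} 2 w) (ends MH i (remainder {n G} 2 w))

  embedAlong-adjacent : ∀ i {w w′} → Adj (G ×ᵍ K₂) w w′ →
    Adj (G ×ᵍ H) (embedAlong i w) (embedAlong i w′)
  embedAlong-adjacent i (q~q′ , r≢r′) = ×-adjacent G H q~q′ (ends-adjacent MH i r≢r′)

  embedAlong-injective : ∀ {i j w w′} → embedAlong i w ≡ embedAlong j w′ → i ≡ j × w ≡ w′
  embedAlong-injective {i} {j} {w} {w′} eq with combine-injective _ _ _ _ eq
  ... | q≡q′ , ends≡ with ends-injective MH _ _ ends≡
  ... | i≡j , r≡r′ = i≡j , remQuot-injective {n G} 2 q≡q′ r≡r′

  matching-× : ∀ {b} → Matching (G ×ᵍ K₂) b → Matching (G ×ᵍ H) (a * b)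
  matching-× MK =
    fromEnds² (λ i p s → embedAlong i (ends MK p s))
      (λ i p → embedAlong-adjacent i (Matching.edge MK p))
      (λ {s = s} {t = t} eq →
        let i≡j , ends≡ = embedAlong-injective eq in i≡j , proj₁ (ends-injective MK s t ends≡))

module Kőnig {G : Graph} (colour : Fin (n G) → Fin 2)
             (proper : ∀ {x y} → Adj G x y → colour x ≢ colour y) where

  V : Set
  V = Fin (n G)

  Left : V → Set
  Left x = colour x ≡ zero

  Left-endpoint : ∀ {x y} → Adj G x y → Left x ⊎ Left y
  Left-endpoint {x} {y} x~y with colour x in cx | colour y in cy
  ... | zero | _ = inj₁ refl
  ... | suc zero | zero = inj₂ refl
  ... | suc zero | suc zero = contradiction (trans cx (sym cy)) (proper x~y)

  record LeftMatching (k : ℕ) : Set where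
    field
      left right      : Fin k → V
      left-Left       : ∀ i → Left (left i)
      edge            : ∀ i → Adj G (left i) (right i)
      left-injective  : Injective _≡_ _≡_ left
      right-injective : Injective _≡_ _≡_ right

    right-¬Left : ∀ i → ¬ Left (right i)
    right-¬Left i right-Left = proper (edge i) (trans (left-Left i) (sym right-Left))

    toMatching : Matching G k
    toMatching = record
      { fst = left
      ; snd = right
      ; edge = edge
      ; disj = λ i j i≢j → i≢j ∘ left-injective , left≢right i j , left≢right j i ∘ sym
                         , i≢j ∘ right-injective
      }
      where
      left≢right : ∀ i j → left i ≢ right j
      left≢right i j eq = right-¬Left j (subst Left eq (left-Left i))

  open LeftMatching

  LeftMatching-bound : ∀ {k} → LeftMatching k → k ≤ n G
  LeftMatching-bound M = injective⇒≤ (left-injective M)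

  emptyLeftMatching : LeftMatching 0
  emptyLeftMatching = record
    { left = λ () ; right = λ () ; left-Left = λ () ; edge = λ ()
    ; left-injective = λ {} ; right-injective = λ {} }

  -- Reach M x d: some alternating path from an unmatched left vertex ends at x after
  -- d matching edges.
  data Reach {k} (M : LeftMatching k) : V → ℕ → Set where
    start : ∀ {x} → Left x → (∀ i → left M i ≢ x) → Reach M x 0
    step  : ∀ {x d} i → Reach M x d → Adj G x (right M i) → Reach M (left M i) (suc d)

  Shortest : ∀ {k} → LeftMatching k → V → ℕ → Set
  Shortest M x d = ∀ e → e < d → ¬ Reach M x e

  module _ {k} (M : LeftMatching k) where

    extend : ∀ {x y} → Left x → Adj G x y → (∀ i → left M i ≢ x) → (∀ i → right M i ≢ y) →
      LeftMatching (suc k)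
    extend {x} {y} x-Left x~y x-free y-free = record
      { left = x ∷ᶠ left M
      ; right = y ∷ᶠ right M
      ; left-Left = λ { zero → x-Left ; (suc i) → left-Left M i }
      ; edge = λ { zero → x~y ; (suc i) → edge M i }
      ; left-injective = ∷ᶠ-injective x-free (left-injective M)
      ; right-injective = ∷ᶠ-injective y-free (right-injective M)
      }

    module Rematch (i : Fin k) {y} (left~y : Adj G (left M i) y) (y-free : ∀ j → right M j ≢ y)
      where
      open UpdateAt (right M) i y

      M′ : LeftMatching k
      M′ = record M
        { right = updateAt (right M) i (const y)
        ; edge = edge′
        ; right-injective = updateAt-injective y-free (right-injective M)
        }
        where
        edge′ : ∀ j → Adj G (left M j) (updateAt (right M) i (const y) j)
        edge′ j with j ≟ i
        ... | yes refl = subst (Adj G (left M i)) (sym updated) left~y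
        ... | no j≢i = subst (Adj G (left M j)) (sym (kept j≢i)) (edge M j)

      right-freed : ∀ j → right M′ j ≢ right M i
      right-freed j with j ≟ i
      ... | yes refl = λ eq → y-free i (trans (sym eq) updated)
      ... | no j≢i = λ eq → j≢i (right-injective M (trans (sym (kept j≢i)) eq))

      reach-rematch : ∀ {x d} → (∀ e → e ≤ d → ¬ Reach M (left M i) e) → Reach M x d → Reach M′ x d
      reach-rematch avoid (start x-Left x-free) = start x-Left x-free
      reach-rematch avoid (step j r x~right) with j ≟ i
      ... | yes refl = contradiction (step j r x~right) (avoid _ ≤-refl)
      ... | no j≢i = step j (reach-rematch (λ e e≤d → avoid e (m≤n⇒m≤1+n e≤d)) r)
                       (subst (Adj G _) (sym (kept j≢i)) x~right)

  -- A shortest path reaches x through its partner y₀. Rematching x to y frees y₀, and the rest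
  -- of the path avoids x by shortness, so it survives; recurse with y₀ in place of y.
  augment : ∀ {k x y d} (M : LeftMatching k) → Acc _<_ d → Reach M x d → Shortest M x d →
    Adj G x y → (∀ j → right M j ≢ y) → ¬ ¬ LeftMatching (suc k)
  augment M _ (start x-Left x-free) _ x~y y-free = pure (extend M x-Left x~y x-free y-free)
  augment M (acc smaller) (step i r x₀~right) shortest left~y y-free = do
    (d′ , d′≤d , r′ , shortest′) ← ¬¬-least (reach-rematch (λ e e≤d → shortest e (s≤s e≤d)) r)
    augment M′ (smaller (s≤s d′≤d)) r′ shortest′ x₀~right right-freed
    where open Rematch M i left~y y-free

  module Cover {k} (M : LeftMatching k) (maximum : ∀ j → LeftMatching j → j ≤ k) where

    Reachable : V → Set
    Reachable x = ∃ (Reach M x)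

    InCover : V → Set
    InCover v = (Left v × ¬ Reachable v) ⊎ (∃ λ x → Reachable x × Adj G x v)

    no-augmenting-path : ∀ {x y d} → Reach M x d → Adj G x y → ¬ (∀ j → right M j ≢ y)
    no-augmenting-path r x~y y-free = ¬¬-least r λ (d′ , _ , r′ , shortest) →
      augment M (<-wellFounded d′) r′ shortest x~y y-free λ M⁺ → 1+n≰n (maximum _ M⁺)

    ChargedTo : Fin k → V → Set
    ChargedTo i v = (left M i ≡ v × ¬ Reachable v)
                  ⊎ (right M i ≡ v × ∃ λ x → Reachable x × Adj G x v)

    charge : ∀ {v} → InCover v → ∃ λ i → ChargedTo i v
    charge (inj₁ (v-Left , unreached)) =
      let i , left≡v = preimage (left M) λ v-free → unreached (0 , start v-Left v-free)
      in i , inj₁ (left≡v , unreached)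
    charge (inj₂ (x , (d , r) , x~v)) =
      let i , right≡v = preimage (right M) (no-augmenting-path r x~v)
      in i , inj₂ (right≡v , x , (d , r) , x~v)

    reach-partner : ∀ {i v w x} → left M i ≡ v → right M i ≡ w → Reachable x → Adj G x w →
      Reachable v
    reach-partner {i} refl refl (d , r) x~w = suc d , step i r x~w

    charge-unique : ∀ {i v w} → ChargedTo i v → ChargedTo i w → v ≡ w
    charge-unique (inj₁ (left≡v , _)) (inj₁ (left≡w , _)) = trans (sym left≡v) left≡w
    charge-unique (inj₂ (right≡v , _)) (inj₂ (right≡w , _)) = trans (sym right≡v) right≡w
    charge-unique (inj₁ (left≡v , unreached)) (inj₂ (right≡w , x , x-reached , x~w)) =
      contradiction (reach-partner left≡v right≡w x-reached x~w) unreached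
    charge-unique (inj₂ (right≡v , x , x-reached , x~v)) (inj₁ (left≡w , unreached)) =
      contradiction (reach-partner left≡w right≡v x-reached x~v) unreached

    module _ (InCover? : ∀ v → Dec (InCover v)) where

      cover : Subset (n G)
      cover = tabulate (does ∘ InCover?)

      covers-from-Left : ∀ {x y} → Left x → Adj G x y → x ∈ cover ⊎ y ∈ cover
      covers-from-Left {x} {y} x-Left x~y with InCover? y
      ... | yes y∈ = inj₂ (∈-tabulate⁺ InCover? y∈)
      ... | no y∉ = inj₁ (∈-tabulate⁺ InCover? (inj₁ (x-Left , x-unreached)))
        where
        x-unreached : ¬ Reachable x
        x-unreached x-reached = y∉ (inj₂ (x , x-reached , x~y))

      cover-covers : IsVertexCover G cover
      cover-covers x y x~y with Left-endpoint x~y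
      ... | inj₁ x-Left = covers-from-Left x-Left x~y
      ... | inj₂ y-Left with covers-from-Left y-Left (Graph.sym G x~y)
      ...   | inj₁ y∈ = inj₂ y∈
      ...   | inj₂ x∈ = inj₁ x∈

      ∣cover∣≤k : ∣ cover ∣ ≤ k
      ∣cover∣≤k = subst (∣ cover ∣ ≤_) (∣⊤∣≡n k)
        (injectiveOn⇒∣p∣≤∣q∣ (proj₁ ∘ charged) (λ _ → ∈⊤) λ v∈ w∈ i≡j →
          charge-unique (proj₂ (charged v∈))
                        (subst (λ i → ChargedTo i _) (sym i≡j) (proj₂ (charged w∈))))
        where
        charged : ∀ {v} → v ∈ cover → ∃ λ i → ChargedTo i v
        charged = charge ∘ ∈-tabulate⁻ InCover?

      smallCover : ∃ λ C → IsVertexCover G C × ∣ C ∣ ≤ k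
      smallCover = cover , cover-covers , ∣cover∣≤k

  kőnig : ¬ ¬ (∃ λ k → LeftMatching k × ∃ λ C → IsVertexCover G C × ∣ C ∣ ≤ k)
  kőnig = do
    (k , M , maximum) ← ¬¬-maximum (n G) (λ _ → LeftMatching-bound) emptyLeftMatching
    InCover? ← ¬¬-∀ λ v → ¬¬-excluded-middle
    pure (k , M , Cover.smallCover M maximum InCover?)

  -- Adjacency need not be decidable, so Kőnig's theorem is only provable under double negation;
  -- α ≤ μ is decidable and thus stable.
  coverNumber≤matchingNumber : ∀ {α μ} → IsVertexCoverNumber G α → IsMatchingNumber G μ → α ≤ μ
  coverNumber≤matchingNumber {α} {μ} (_ , minimum) (_ , maximum) =
    decidable-stable (α ≤? μ) (¬¬-map (λ (k , M , C , C-covers , ∣C∣≤k) →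
      ≤-trans (minimum C C-covers) (≤-trans ∣C∣≤k (maximum k (toMatching M)))) kőnig)

  coverNumber≡matchingNumber : ∀ {α μ} → IsVertexCoverNumber G α → IsMatchingNumber G μ → α ≡ μ
  coverNumber≡matchingNumber α-number μ-number@(M , _) =
    ≤-antisym (coverNumber≤matchingNumber α-number μ-number) (matching≤coverNumber M α-number)

lemma18 : (G H : Graph) → NonTrivial G → NonEmpty G → NonTrivial H → NonEmpty H →
    (aGH μH aGK μGK μG : ℕ) →
    IsVertexCoverNumber (G ×ᵍ H) aGH → IsMatchingNumber H μH →
    IsVertexCoverNumber (G ×ᵍ K₂) aGK → IsMatchingNumber (G ×ᵍ K₂) μGK →
    IsMatchingNumber G μG →
    (aGH ≥ μH * aGK) × (μH * aGK ≡ μH * μGK) × (μH * μGK ≥ 2 * μG * μH)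
lemma18 G H _ _ _ _ aGH μH aGK μGK μG αGH (MH , _) αGK μGK-number@(MGK , μGK-maximum) (MG , _) =
  subst (λ a → μH * a ≤ aGH) (sym α≡μ) product≤αGH , cong (μH *_) α≡μ , doubled
  where
  α≡μ : aGK ≡ μGK
  α≡μ = Kőnig.coverNumber≡matchingNumber {G ×ᵍ K₂} (remainder {n G} 2) proj₂ αGK μGK-number

  product≤αGH : μH * μGK ≤ aGH
  product≤αGH = matching≤coverNumber (matching-× {G} MH MGK) αGH

  doubled : 2 * μG * μH ≤ μH * μGK
  doubled = begin
    2 * μG * μH     ≡⟨ *-comm (2 * μG) μH ⟩
    μH * (2 * μG)   ≡⟨ cong (μH *_) (*-comm 2 μG) ⟩
    μH * (μG * 2)   ≤⟨ *-monoʳ-≤ μH (μGK-maximum _ (matching-×K₂ MG)) ⟩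
    μH * μGK        ∎
    where open ≤-Reasoning
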